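{- $\chi(K(8,3,1))\le 12$.
   Context: For integers $i\le k\le n$, the generalized Kneser graph $K(n,k,i)$ has vertex set $\{A\subseteq \{1,\ldots,n\}:\ |A|=k\}$, two distinct vertices $A,B$ being adjacent iff $|A\cap B|\le i$. $\chi$ denotes the chromatic number. -}

module Defs where

open import Data.Nat using (ℕ; _≤_)
open import Data.Fin using (Fin)
open import Data.Fin.Subset using (Subset; ∣_∣; _∩_)
open import Data.Product using (Σ; proj₁; _×_)
open import Relation.Binary.PropositionalEquality using (_≡_; _≢_)

KVertex : ℕ → ℕ → Set
KVertex n k = Σ (Subset n) (λ A → ∣ A ∣ ≡ k)

KAdj : (n k i : ℕ) → KVertex n k → KVertex n k → Set
KAdj n k i A B = (proj₁ A ≢ proj₁ B) × (∣ proj₁ A ∩ proj₁ B ∣ ≤ i)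

ProperColouring : (n k i c : ℕ) → (KVertex n k → Fin c) → Set
ProperColouring n k i c f = ∀ A B → KAdj n k i A B → f A ≢ f B

χ≤ : (n k i c : ℕ) → Set
χ≤ n k i c = Σ (KVertex n k → Fin c) (ProperColouring n k i c)

-- Colour the triples by twelve families each of whose members pairwise meet in at least
-- two points: the triples through a fixed pair (eight pairs), and the triples inside a
-- fixed 4-set (four 4-sets; two such triples span at most four points, so they share two).
-- A computation checks that these families cover all 56 triples of an 8-set; triples
-- meeting in at most one point then never share a colour.
module Submission where

open import Defs
open import Data.Nat using (ℕ; zero; suc; _+_; _∸_; _≤_; _≤?_; _≟_)
open import Data.Nat.Properties using (+-suc; +-monoˡ-≤; m≤n+o⇒m∸n≤o; <⇒≱; ≤-trans)
open import Data.Fin using (Fin; #_)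
open import Data.Fin.Properties using (any?; all?)
open import Data.Fin.Subset using (Subset; inside; outside; ∣_∣; _∩_; _∪_; _⊆_; ⁅_⁆)
open import Data.Fin.Subset.Properties using (_⊆?_; p⊆q⇒∣p∣≤∣q∣; x∈p∩q⁺; x∈p∪q⁻)
open import Data.Vec using ([]; _∷_; lookup)
open import Data.Product using (∃; _,_; proj₁; proj₂)
open import Data.Sum using ([_,_])
open import Function using (_∘_)
open import Relation.Nullary using (Dec)
open import Relation.Nullary.Decidable using (map′; _×-dec_; _→-dec_; toWitness)
open import Relation.Unary using (Pred; Decidable)
open import Relation.Binary.PropositionalEquality using (_≡_; refl; cong; cong₂; sym; trans; subst)

private
  variable
    n : ℕ

allSubset? : ∀ {ℓ} {P : Pred (Subset n) ℓ} → Decidable P → Dec (∀ p → P p)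
allSubset? {zero}  P? = map′ (λ { P[] [] → P[] }) (λ ∀P → ∀P []) (P? [])
allSubset? {suc n} P? =
  map′ (λ { (∀Pᵢ , ∀Pₒ) (inside ∷ p) → ∀Pᵢ p ; (∀Pᵢ , ∀Pₒ) (outside ∷ p) → ∀Pₒ p })
       (λ ∀P → ∀P ∘ (inside ∷_) , ∀P ∘ (outside ∷_))
       (allSubset? (P? ∘ (inside ∷_)) ×-dec allSubset? (P? ∘ (outside ∷_)))

∣p∪q∣+∣p∩q∣≡∣p∣+∣q∣ : (p q : Subset n) → ∣ p ∪ q ∣ + ∣ p ∩ q ∣ ≡ ∣ p ∣ + ∣ q ∣
∣p∪q∣+∣p∩q∣≡∣p∣+∣q∣ []            []            = refl
∣p∪q∣+∣p∩q∣≡∣p∣+∣q∣ (outside ∷ p) (outside ∷ q) = ∣p∪q∣+∣p∩q∣≡∣p∣+∣q∣ p q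
∣p∪q∣+∣p∩q∣≡∣p∣+∣q∣ (inside  ∷ p) (outside ∷ q) = cong suc (∣p∪q∣+∣p∩q∣≡∣p∣+∣q∣ p q)
∣p∪q∣+∣p∩q∣≡∣p∣+∣q∣ (outside ∷ p) (inside  ∷ q) =
  trans (cong suc (∣p∪q∣+∣p∩q∣≡∣p∣+∣q∣ p q)) (sym (+-suc ∣ p ∣ ∣ q ∣))
∣p∪q∣+∣p∩q∣≡∣p∣+∣q∣ (inside  ∷ p) (inside  ∷ q) = begin
  suc (∣ p ∪ q ∣ + suc ∣ p ∩ q ∣) ≡⟨ cong suc (+-suc ∣ p ∪ q ∣ ∣ p ∩ q ∣) ⟩
  suc (suc (∣ p ∪ q ∣ + ∣ p ∩ q ∣)) ≡⟨ cong (suc ∘ suc) (∣p∪q∣+∣p∩q∣≡∣p∣+∣q∣ p q) ⟩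
  suc (suc (∣ p ∣ + ∣ q ∣))         ≡⟨ cong suc (+-suc ∣ p ∣ ∣ q ∣) ⟨
  suc (∣ p ∣ + suc ∣ q ∣)           ∎
  where open Relation.Binary.PropositionalEquality.≡-Reasoning

∣r∣≤∣p∩q∣ : {r p q : Subset n} → r ⊆ p → r ⊆ q → ∣ r ∣ ≤ ∣ p ∩ q ∣
∣r∣≤∣p∩q∣ r⊆p r⊆q = p⊆q⇒∣p∣≤∣q∣ (λ x∈r → x∈p∩q⁺ (r⊆p x∈r , r⊆q x∈r))

∣p∣+∣q∣≤∣r∣+∣p∩q∣ : {p q r : Subset n} → p ⊆ r → q ⊆ r → ∣ p ∣ + ∣ q ∣ ≤ ∣ r ∣ + ∣ p ∩ q ∣
∣p∣+∣q∣≤∣r∣+∣p∩q∣ {p = p} {q} {r} p⊆r q⊆r = begin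
  ∣ p ∣ + ∣ q ∣         ≡⟨ ∣p∪q∣+∣p∩q∣≡∣p∣+∣q∣ p q ⟨
  ∣ p ∪ q ∣ + ∣ p ∩ q ∣ ≤⟨ +-monoˡ-≤ ∣ p ∩ q ∣ (p⊆q⇒∣p∣≤∣q∣ p∪q⊆r) ⟩
  ∣ r ∣ + ∣ p ∩ q ∣     ∎
  where
  open Data.Nat.Properties.≤-Reasoning
  p∪q⊆r : p ∪ q ⊆ r
  p∪q⊆r x∈p∪q = [ p⊆r , q⊆r ] (x∈p∪q⁻ p q x∈p∪q)

data Block (n : ℕ) : Set where
  containing within : Subset n → Block n

_∈ᴮ_ : Subset n → Block n → Set
A ∈ᴮ containing P = P ⊆ A
A ∈ᴮ within Q     = A ⊆ Q

_∈ᴮ?_ : (A : Subset n) (b : Block n) → Dec (A ∈ᴮ b)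
A ∈ᴮ? containing P = P ⊆? A
A ∈ᴮ? within Q     = A ⊆? Q

minOverlap : ℕ → Block n → ℕ
minOverlap k (containing P) = ∣ P ∣
minOverlap k (within Q)     = k + k ∸ ∣ Q ∣

minOverlap≤∣∩∣ : ∀ {k} (b : Block n) {A B : Subset n} → ∣ A ∣ ≡ k → ∣ B ∣ ≡ k →
                 A ∈ᴮ b → B ∈ᴮ b → minOverlap k b ≤ ∣ A ∩ B ∣
minOverlap≤∣∩∣ (containing P) _ _ P⊆A P⊆B = ∣r∣≤∣p∩q∣ P⊆A P⊆B
minOverlap≤∣∩∣ {k = k} (within Q) {A} {B} ∣A∣≡k ∣B∣≡k A⊆Q B⊆Q =
  m≤n+o⇒m∸n≤o (k + k) ∣ Q ∣ (subst (_≤ ∣ Q ∣ + ∣ A ∩ B ∣)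
    (cong₂ _+_ ∣A∣≡k ∣B∣≡k) (∣p∣+∣q∣≤∣r∣+∣p∩q∣ A⊆Q B⊆Q))

Covers : (n k : ℕ) {c : ℕ} → (Fin c → Block n) → Set
Covers n k block = ∀ (A : Subset n) → ∣ A ∣ ≡ k → ∃ λ b → A ∈ᴮ block b

covers? : ∀ k {c} (block : Fin c → Block n) → Dec (Covers n k block)
covers? k block = allSubset? λ A → (∣ A ∣ ≟ k) →-dec any? (λ b → A ∈ᴮ? block b)

block-colouring : ∀ {n k i c} (block : Fin c → Block n) →
                  (∀ b → suc i ≤ minOverlap k (block b)) → Covers n k block → χ≤ n k i c
block-colouring {n} {k} {i} {c} block intersecting covers = colour , proper
  where
  colour : KVertex n k → Fin c
  colour (A , ∣A∣≡k) = proj₁ (covers A ∣A∣≡k)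

  proper : ProperColouring n k i c colour
  proper (A , ∣A∣≡k) (B , ∣B∣≡k) (_ , ∣A∩B∣≤i) same =
    <⇒≱ (≤-trans (intersecting b) (minOverlap≤∣∩∣ (block b) ∣A∣≡k ∣B∣≡k A∈b B∈b)) ∣A∩B∣≤i
    where
    b = colour (A , ∣A∣≡k)
    A∈b = proj₂ (covers A ∣A∣≡k)
    B∈b = subst (λ b′ → B ∈ᴮ block b′) (sym same) (proj₂ (covers B ∣B∣≡k))

pair : Fin n → Fin n → Subset n
pair x y = ⁅ x ⁆ ∪ ⁅ y ⁆

blocks : Fin 12 → Block 8
blocks = lookup
  ( containing (pair (# 0) (# 5)) ∷ containing (pair (# 3) (# 6))
  ∷ containing (pair (# 1) (# 7)) ∷ containing (pair (# 2) (# 6))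
  ∷ containing (pair (# 1) (# 5)) ∷ containing (pair (# 0) (# 7))
  ∷ containing (pair (# 2) (# 4)) ∷ containing (pair (# 3) (# 4))
  ∷ within (pair (# 0) (# 1) ∪ pair (# 2) (# 3)) ∷ within (pair (# 0) (# 1) ∪ pair (# 4) (# 6))
  ∷ within (pair (# 2) (# 3) ∪ pair (# 5) (# 7)) ∷ within (pair (# 4) (# 5) ∪ pair (# 6) (# 7))
  ∷ [])

proposition4p11 : χ≤ 8 3 1 12
proposition4p11 = block-colouring blocks
  (toWitness {a? = all? λ b → 2 ≤? minOverlap 3 (blocks b)} _)
  (toWitness {a? = covers? 3 blocks} _)
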